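{- Let $G$ be the complement of a bipartite graph. Then $Tr(G)=D(G)$.
   Context: All graphs are finite and simple. For disjoint vertex sets $A,B$, $A$ dominates $B$ if every vertex of $B$ is adjacent to at least one vertex of $A$. A transitive $k$-partition is a partition of $V(G)$ into $k$ nonempty parts $V_1,\dots,V_k$ with $V_i$ dominating $V_j$ for all $1\le i<j\le k$; $Tr(G)$ is the maximum such $k$. An upper domatic partition of size $k$ is a partition of $V(G)$ into $k$ nonempty parts such that for any two parts $V_i,V_j$, $V_i$ dominates $V_j$ or $V_j$ dominates $V_i$ (or both); $D(G)$ is the maximum such $k$. -}

module Defs where

open import Data.Nat using (ℕ; _≤_)
open import Data.Fin using (Fin; _<_)
open import Data.Fin.Properties using (_≟_)
open import Data.Bool using (Bool; true; false; not; if_then_else_)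
open import Data.Product using (Σ; ∃; _×_; _,_)
open import Data.Sum using (_⊎_)
open import Function using (Surjective)
open import Relation.Binary.PropositionalEquality using (_≡_; _≢_)
open import Relation.Nullary using (does)

record Graph (n : ℕ) : Set where
  field
    Adj    : Fin n → Fin n → Bool
    sym    : ∀ u v → Adj u v ≡ Adj v u
    irrefl : ∀ v → Adj v v ≡ false
open Graph public

Bipartite : ∀ {n} → Graph n → Set
Bipartite {n} H = Σ (Fin n → Bool) λ c →
  ∀ u v → Adj H u v ≡ true → c u ≢ c v

complAdj : ∀ {n} → Graph n → Fin n → Fin n → Bool
complAdj H u v = if does (u ≟ v) then false else not (Adj H u v)

CoBipartite : ∀ {n} → Graph n → Set
CoBipartite {n} G = Σ (Graph n) λ H →
  Bipartite H × (∀ u v → Adj G u v ≡ complAdj H u v)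

-- A partition of V(G) into k nonempty parts is a surjection p : Fin n → Fin k
-- (part V_i = p⁻¹(i)).  Part i dominates part j:
Dominates : ∀ {n k} → Graph n → (Fin n → Fin k) → Fin k → Fin k → Set
Dominates {n} G p i j =
  ∀ v → p v ≡ j → ∃ λ u → p u ≡ i × Adj G u v ≡ true

IsTransitivePartition : ∀ {n k} → Graph n → (Fin n → Fin k) → Set
IsTransitivePartition G p =
  Surjective _≡_ _≡_ p × (∀ i j → i < j → Dominates G p i j)

HasTransitivePartition : ∀ {n} → Graph n → ℕ → Set
HasTransitivePartition {n} G k =
  Σ (Fin n → Fin k) λ p → IsTransitivePartition G p

IsUpperDomaticPartition : ∀ {n k} → Graph n → (Fin n → Fin k) → Set
IsUpperDomaticPartition G p =
  Surjective _≡_ _≡_ p ×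
  (∀ i j → i ≢ j → Dominates G p i j ⊎ Dominates G p j i)

HasUpperDomaticPartition : ∀ {n} → Graph n → ℕ → Set
HasUpperDomaticPartition {n} G k =
  Σ (Fin n → Fin k) λ p → IsUpperDomaticPartition G p

IsMaximum : (ℕ → Set) → ℕ → Set
IsMaximum P m = P m × (∀ k → P k → k ≤ m)

IsTr : ∀ {n} → Graph n → ℕ → Set
IsTr G = IsMaximum (HasTransitivePartition G)

IsD : ∀ {n} → Graph n → ℕ → Set
IsD G = IsMaximum (HasUpperDomaticPartition G)

{-# OPTIONS --safe #-}
-- Let c be a 2-colouring of the bipartite complement, so that any two distinct
-- vertices of the same colour are adjacent in G.  A transitive partition is upper
-- domatic, so Tr(G) ≤ D(G).  Conversely, from an upper domatic partition we
-- repeatedly split off a part that dominates all other parts and put it first.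
-- A part containing both colours is such a source: every other vertex has a
-- neighbour of its own colour in it.  If all parts are monochromatic and each
-- colour has a part with two vertices, exchanging one vertex between two such parts
-- makes both of them mixed without touching the other parts.
-- Otherwise the vertices of one colour b are alone in their parts, and a part
-- containing a vertex v of the other colour (any part, if there is none) is a
-- source: a vertex w of another part either has the colour of v, or forms a
-- singleton part, and then either of the two dominations gives the edge vw.
module Submission where

open import Defs
open import Data.Nat using (ℕ)
open import Relation.Binary.PropositionalEquality using (_≡_)

open import Data.Nat using (zero; suc; s≤s)
open import Data.Nat.Properties using (≤-antisym)
open import Data.Fin using (Fin; zero; suc; _<_; punchIn; punchOut)
open import Data.Fin.Properties
  using ( _≟_; any?; <-cmp; punchIn-injective; punchInᵢ≢i
        ; punchIn-punchOut; punchOut-punchIn; punchOut-cong)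
open import Data.Bool using (Bool; true; false; if_then_else_)
open import Data.Bool.Properties using (¬-not) renaming (_≟_ to _≟ᵇ_)
open import Data.Maybe using (Maybe; just; nothing; fromMaybe)
open import Data.Maybe.Properties using (just-injective; ≡-dec)
open import Data.Product using (∃; ∃₂; _×_; _,_; proj₁)
open import Data.Sum using (_⊎_; inj₁; inj₂)
import Data.Sum as Sum
open import Function using (_∘_; id; Surjective)
open import Function.Bundles using (_⇔_; mk⇔; Equivalence)
open import Relation.Binary.Definitions using (tri<; tri≈; tri>)
import Relation.Binary.PropositionalEquality as ≡
open ≡ using (refl; trans; cong; cong₂; _≢_; ≢-sym)
open import Relation.Nullary using (Dec; yes; no; ¬_; does; contradiction)
open import Relation.Nullary.Decidable using (_×-dec_; ¬?; dec-true; dec-false; decidable-stable)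

≢-≢⇒≡ : ∀ {x y z : Bool} → x ≢ y → x ≢ z → y ≡ z
≢-≢⇒≡ x≢y x≢z = trans (¬-not (≢-sym x≢y)) (≡.sym (¬-not (≢-sym x≢z)))

assigned? : ∀ {A : Set} (m : Maybe A) → Dec (∃ λ a → m ≡ just a)
assigned? (just a) = yes (a , refl)
assigned? nothing  = no λ { (_ , ()) }

transitive⇒upperDomatic : ∀ {n} (G : Graph n) {k} →
  HasTransitivePartition G k → HasUpperDomaticPartition G k
transitive⇒upperDomatic G (p , onto , dom) = p , onto , compare
  where
  compare : ∀ i j → i ≢ j → Dominates G p i j ⊎ Dominates G p j i
  compare i j i≢j with <-cmp i j
  ... | tri< i<j _ _ = inj₁ (dom i j i<j)
  ... | tri≈ _ i≡j _ = contradiction i≡j i≢j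
  ... | tri> _ _ j<i = inj₂ (dom j i j<i)

coBipartite-sameColour⇒adjacent : ∀ {n} {G H : Graph n} {c : Fin n → Bool} →
  (∀ u v → Adj H u v ≡ true → c u ≢ c v) → (∀ u v → Adj G u v ≡ complAdj H u v) →
  ∀ {u v} → u ≢ v → c u ≡ c v → Adj G u v ≡ true
coBipartite-sameColour⇒adjacent {H = H} bipartite G≡H̄ {u} {v} u≢v cu≡cv
  rewrite G≡H̄ u v | dec-false (u ≟ v) u≢v with Adj H u v in uv
... | true  = contradiction cu≡cv (bipartite u v uv)
... | false = refl

module Partial {n : ℕ} (G : Graph n) where

  -- A partial partition into k parts: v lies in part i iff q v ≡ just i, and the
  -- vertices labelled nothing have been discarded.
  Labelling : ℕ → Set
  Labelling k = Fin n → Maybe (Fin k)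

  Dom : ∀ {k} → Labelling k → Fin k → Fin k → Set
  Dom q i j = ∀ v → q v ≡ just j → ∃ λ u → q u ≡ just i × Adj G u v ≡ true

  Onto : ∀ {k} → Labelling k → Set
  Onto q = ∀ i → ∃ λ v → q v ≡ just i

  UpperDomatic : ∀ {k} → Labelling k → Set
  UpperDomatic q = Onto q × (∀ i j → i ≢ j → Dom q i j ⊎ Dom q j i)

  Transitive : ∀ {k} → Labelling k → Set
  Transitive q = Onto q × (∀ i j → i < j → Dom q i j)

  Source : ∀ {k} → Labelling k → Fin k → Set
  Source q s = ∀ j → j ≢ s → Dom q s j

  infix 4 _⊆_
  _⊆_ : ∀ {k l} → Labelling k → Labelling l → Set
  q′ ⊆ q = ∀ v → q v ≡ nothing → q′ v ≡ nothing

  ⊆-refl : ∀ {k} {q : Labelling k} → q ⊆ q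
  ⊆-refl v = id

  ⊆-trans : ∀ {k l m} {q : Labelling k} {q′ : Labelling l} {q″ : Labelling m} →
    q ⊆ q′ → q′ ⊆ q″ → q ⊆ q″
  ⊆-trans q⊆q′ q′⊆q″ v = q⊆q′ v ∘ q′⊆q″ v

  SamePart : ∀ {k} → Labelling k → Fin n → Fin n → Set
  SamePart q u v = ∃ λ i → q u ≡ just i × q v ≡ just i

  samePart? : ∀ {k} (q : Labelling k) u v → Dec (SamePart q u v)
  samePart? q u v with assigned? (q u) | ≡-dec _≟_ (q u) (q v)
  ... | yes (i , qu) | yes qu≡qv = yes (i , qu , trans (≡.sym qu≡qv) qu)
  ... | no unassigned | _ = no λ { (i , qu , _) → unassigned (i , qu) }
  ... | _ | no qu≢qv = no λ { (i , qu , qv) → qu≢qv (trans qu (≡.sym qv)) }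

  Alone : ∀ {k} → Labelling k → Fin n → Set
  Alone q w = ∀ u → SamePart q u w → u ≡ w

  labels-distinct : ∀ {k} {q : Labelling k} {u v i j} →
    q u ≡ just i → q v ≡ just j → i ≢ j → u ≢ v
  labels-distinct qu qv i≢j refl = i≢j (just-injective (trans (≡.sym qu) qv))

  erase : ∀ {k} → Fin (suc k) → Maybe (Fin (suc k)) → Maybe (Fin k)
  erase s nothing = nothing
  erase s (just i) with s ≟ i
  ... | yes _   = nothing
  ... | no s≢i = just (punchOut s≢i)

  erase-self : ∀ {k} (s : Fin (suc k)) → erase s (just s) ≡ nothing
  erase-self s with s ≟ s
  ... | yes _   = refl
  ... | no s≢s = contradiction refl s≢s

  erase-punchIn : ∀ {k} (s : Fin (suc k)) i → erase s (just (punchIn s i)) ≡ just i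
  erase-punchIn s i with s ≟ punchIn s i
  ... | yes s≡ = contradiction (≡.sym s≡) (punchInᵢ≢i s i)
  ... | no _   = cong just (trans (punchOut-cong s refl) (punchOut-punchIn s))

  erase-≡just : ∀ {k} (s : Fin (suc k)) m {i} → erase s m ≡ just i → m ≡ just (punchIn s i)
  erase-≡just s (just j) e with s ≟ j
  ... | no s≢j =
    cong just (trans (≡.sym (punchIn-punchOut s≢j)) (cong (punchIn s) (just-injective e)))

  upperDomatic-erase : ∀ {k} {q : Labelling (suc k)} s →
    UpperDomatic q → UpperDomatic (erase s ∘ q)
  upperDomatic-erase {q = q} s (onto , compare) = onto′ , compare′
    where
    onto′ : Onto (erase s ∘ q)
    onto′ i = let v , qv = onto (punchIn s i) in
      v , trans (cong (erase s) qv) (erase-punchIn s i)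
    lift : ∀ {i j} → Dom q (punchIn s i) (punchIn s j) → Dom (erase s ∘ q) i j
    lift {i} d v e = let u , qu , adj = d v (erase-≡just s (q v) e) in
      u , trans (cong (erase s) qu) (erase-punchIn s i) , adj
    compare′ : ∀ i j → i ≢ j → Dom (erase s ∘ q) i j ⊎ Dom (erase s ∘ q) j i
    compare′ i j i≢j = Sum.map lift lift (compare _ _ (i≢j ∘ punchIn-injective s i j))

  -- Part s of the first labelling becomes part zero, in front of the parts of the
  -- second one (a partial partition of the remaining vertices).
  prepend : ∀ {k} → Fin (suc k) → Maybe (Fin (suc k)) → Maybe (Fin k) → Maybe (Fin (suc k))
  prepend s m        (just i) = just (suc i)
  prepend s nothing  nothing  = nothing
  prepend s (just j) nothing  = if does (j ≟ s) then just zero else nothing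

  prepend-self : ∀ {k} (s : Fin (suc k)) → prepend s (just s) nothing ≡ just zero
  prepend-self s rewrite dec-true (s ≟ s) refl = refl

  prepend-≡suc : ∀ {k} {s : Fin (suc k)} {m m′ j} → prepend s m m′ ≡ just (suc j) → m′ ≡ just j
  prepend-≡suc {m′ = just i} refl = refl
  prepend-≡suc {s = s} {just i} {nothing} e with i ≟ s
  prepend-≡suc {s = s} {just i} {nothing} () | yes _
  prepend-≡suc {s = s} {just i} {nothing} () | no _

  transitive-prepend : ∀ {k} {q : Labelling (suc k)} {q′ : Labelling k} {s} →
    (∃ λ v → q v ≡ just s) → Source q s → Transitive q′ → q′ ⊆ erase s ∘ q →
    Transitive (λ v → prepend s (q v) (q′ v)) × (λ v → prepend s (q v) (q′ v)) ⊆ q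
  transitive-prepend {q = q} {q′} {s} (v₀ , qv₀) source (onto′ , dom′) q′⊆q =
    (onto , dom) , r⊆q
    where
    r : Labelling _
    r v = prepend s (q v) (q′ v)
    r-source : ∀ {v} → q v ≡ just s → r v ≡ just zero
    r-source {v} qv = trans (cong₂ (prepend s) qv q′v≡nothing) (prepend-self s)
      where
      q′v≡nothing : q′ v ≡ nothing
      q′v≡nothing = q′⊆q v (trans (cong (erase s) qv) (erase-self s))
    onto : Onto r
    onto zero    = v₀ , r-source qv₀
    onto (suc i) = let v , q′v = onto′ i in v , cong (prepend s (q v)) q′v
    dom : ∀ i j → i < j → Dom r i j
    dom _ zero ()
    dom zero (suc j) _ v rv with erase s (q v) in qv
    ... | nothing = contradiction (trans (≡.sym (prepend-≡suc rv)) (q′⊆q v qv)) λ ()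
    ... | just y  =
      let u , qu , adj = source (punchIn s y) (punchInᵢ≢i s y) v (erase-≡just s (q v) qv) in
      u , r-source qu , adj
    dom (suc i) (suc j) (s≤s i<j) v rv =
      let u , q′u , adj = dom′ i j i<j v (prepend-≡suc rv) in u , cong (prepend s (q u)) q′u , adj
    r⊆q : r ⊆ q
    r⊆q v qv = cong₂ (prepend s) qv (q′⊆q v (cong (erase s) qv))

  SourceRefinement : ∀ {k} → Labelling (suc k) → Set
  SourceRefinement {k} q =
    ∃₂ λ (q₁ : Labelling (suc k)) s → UpperDomatic q₁ × Source q₁ s × q₁ ⊆ q

  AdmitsSourceRefinements : Set
  AdmitsSourceRefinements = ∀ {k} (q : Labelling (suc k)) → UpperDomatic q → SourceRefinement q

  transitive-refinement : AdmitsSourceRefinements →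
    ∀ {k} (q : Labelling k) → UpperDomatic q →
    ∃ λ (q′ : Labelling k) → Transitive q′ × q′ ⊆ q
  transitive-refinement refine {zero} q _ = q , ((λ ()) , (λ ())) , ⊆-refl
  transitive-refinement refine {suc k} q ud with refine q ud
  ... | q₁ , s , ud₁ , source , q₁⊆q
    with transitive-refinement refine (erase s ∘ q₁) (upperDomatic-erase s ud₁)
  ... | q₂ , transitive₂ , q₂⊆q₁ =
    let transitive , r⊆q₁ = transitive-prepend (proj₁ ud₁ s) source transitive₂ q₂⊆q₁ in
    _ , transitive , ⊆-trans r⊆q₁ q₁⊆q

  upperDomatic-just : ∀ {k} {p : Fin n → Fin k} →
    IsUpperDomaticPartition G p → UpperDomatic (just ∘ p)
  upperDomatic-just {p = p} (onto , compare) =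
    onto′ , λ i j i≢j → Sum.map lift lift (compare i j i≢j)
    where
    onto′ : Onto (just ∘ p)
    onto′ i = let v , pv = onto i in v , cong just (pv refl)
    lift : ∀ {i j} → Dominates G p i j → Dom (just ∘ p) i j
    lift d v pv = let u , pu , adj = d v (just-injective pv) in u , cong just pu , adj

  -- The discarded vertices join part zero, which never has to be dominated.
  transitive-fromMaybe : ∀ {k} {q : Labelling (suc k)} →
    Transitive q → IsTransitivePartition G (fromMaybe zero ∘ q)
  transitive-fromMaybe {q = q} (onto , dom) = onto′ , dom′
    where
    onto′ : Surjective _≡_ _≡_ (fromMaybe zero ∘ q)
    onto′ i = let v , qv = onto i in v , λ { refl → cong (fromMaybe zero) qv }
    dom′ : ∀ i j → i < j → Dominates G (fromMaybe zero ∘ q) i j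
    dom′ _ zero ()
    dom′ i (suc j) i<j v pv with q v in qv
    ... | nothing = contradiction pv λ ()
    ... | just _  =
      let u , qu , adj = dom i (suc j) i<j v (trans qv (cong just pv)) in
      u , cong (fromMaybe zero) qu , adj

  upperDomatic⇒transitive : AdmitsSourceRefinements →
    ∀ {k} → HasUpperDomaticPartition G k → HasTransitivePartition G k
  upperDomatic⇒transitive refine {zero} (p , onto , _) = p , onto , λ ()
  upperDomatic⇒transitive refine {suc k} (p , ud) =
    let q , transitive , _ = transitive-refinement refine (just ∘ p) (upperDomatic-just ud) in
    fromMaybe zero ∘ q , transitive-fromMaybe transitive

  exchange : ∀ {k} → Fin n → Fin n → Labelling k → Labelling k
  exchange u w q v = if does (v ≟ u) then q w else if does (v ≟ w) then q u else q v

  exchange-left : ∀ {k} (q : Labelling k) u w → exchange u w q u ≡ q w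
  exchange-left q u w rewrite dec-true (u ≟ u) refl = refl

  exchange-right : ∀ {k} (q : Labelling k) u w → u ≢ w → exchange u w q w ≡ q u
  exchange-right q u w u≢w
    rewrite dec-false (w ≟ u) (≢-sym u≢w) | dec-true (w ≟ w) refl = refl

  exchange-other : ∀ {k} (q : Labelling k) u w {v} → v ≢ u → v ≢ w → exchange u w q v ≡ q v
  exchange-other q u w {v} v≢u v≢w
    rewrite dec-false (v ≟ u) v≢u | dec-false (v ≟ w) v≢w = refl

  exchange-agrees : ∀ {k} {q : Labelling k} {u w i j} → q u ≡ just i → q w ≡ just j →
    ∀ v {l} → l ≢ i → l ≢ j → exchange u w q v ≡ just l ⇔ q v ≡ just l
  exchange-agrees {q = q} {u} {w} qu qw v {l} l≢i l≢j = mk⇔ to from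
    where
    to : exchange u w q v ≡ just l → q v ≡ just l
    to e with v ≟ u | v ≟ w
    ... | yes _ | _     = contradiction (just-injective (trans (≡.sym e) qw)) l≢j
    ... | no _  | yes _ = contradiction (just-injective (trans (≡.sym e) qu)) l≢i
    ... | no _  | no _  = e
    from : q v ≡ just l → exchange u w q v ≡ just l
    from e = trans (exchange-other q u w (labels-distinct e qu l≢i) (labels-distinct e qw l≢j)) e

  exchange-⊆ : ∀ {k} {q : Labelling k} {u w i j} →
    q u ≡ just i → q w ≡ just j → exchange u w q ⊆ q
  exchange-⊆ {q = q} {u} {w} qu qw v qv =
    trans (exchange-other q u w (unassigned≢ qu) (unassigned≢ qw)) qv
    where
    unassigned≢ : ∀ {x i} → _ ≡ just i → v ≢ x
    unassigned≢ qx refl = contradiction (trans (≡.sym qv) qx) λ ()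

  upperDomatic-replace : ∀ {k} {q q₁ : Labelling k} {i j} → UpperDomatic q →
    (∀ v {l} → l ≢ i → l ≢ j → q₁ v ≡ just l ⇔ q v ≡ just l) →
    (∃ λ v → q₁ v ≡ just i) → (∃ λ v → q₁ v ≡ just j) → Source q₁ i → Source q₁ j →
    UpperDomatic q₁
  upperDomatic-replace {q = q} {q₁} {i} {j}
    (onto , compare) agree inhabited-i inhabited-j source-i source-j = onto₁ , compare₁
    where
    onto₁ : Onto q₁
    onto₁ l with l ≟ i | l ≟ j
    ... | yes refl | _        = inhabited-i
    ... | no _     | yes refl = inhabited-j
    ... | no l≢i   | no l≢j   = let v , qv = onto l in v , Equivalence.from (agree v l≢i l≢j) qv
    lift : ∀ {l m} → l ≢ i → l ≢ j → m ≢ i → m ≢ j → Dom q l m → Dom q₁ l m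
    lift l≢i l≢j m≢i m≢j d v q₁v =
      let u , qu , adj = d v (Equivalence.to (agree v m≢i m≢j) q₁v) in
      u , Equivalence.from (agree u l≢i l≢j) qu , adj
    compare₁ : ∀ l m → l ≢ m → Dom q₁ l m ⊎ Dom q₁ m l
    compare₁ l m l≢m with l ≟ i | l ≟ j | m ≟ i | m ≟ j
    ... | yes refl | _        | _        | _        = inj₁ (source-i m (≢-sym l≢m))
    ... | _        | yes refl | _        | _        = inj₁ (source-j m (≢-sym l≢m))
    ... | _        | _        | yes refl | _        = inj₂ (source-i l l≢m)
    ... | _        | _        | _        | yes refl = inj₂ (source-j l l≢m)
    ... | no l≢i   | no l≢j   | no m≢i   | no m≢j   =
      Sum.map (lift l≢i l≢j m≢i m≢j) (lift m≢i m≢j l≢i l≢j) (compare l m l≢m)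

module CliqueCover {n : ℕ} (G : Graph n) (c : Fin n → Bool)
  (sameColour⇒adjacent : ∀ {u v} → u ≢ v → c u ≡ c v → Adj G u v ≡ true) where

  open Partial G

  sameColour-dominator : ∀ {k} {q : Labelling k} {u w i j} → q u ≡ just i → q w ≡ just j →
    j ≢ i → c u ≡ c w → ∃ λ x → q x ≡ just i × Adj G x w ≡ true
  sameColour-dominator qu qw j≢i cu≡cw =
    _ , qu , sameColour⇒adjacent (labels-distinct qu qw (≢-sym j≢i)) cu≡cw

  source-if-mixed : ∀ {k} {q : Labelling k} {u u′ i} →
    q u ≡ just i → q u′ ≡ just i → c u ≢ c u′ → Source q i
  source-if-mixed {u = u} qu qu′ cu≢cu′ j j≢i w qw with c u ≟ᵇ c w
  ... | yes cu≡cw = sameColour-dominator qu qw j≢i cu≡cw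
  ... | no cu≢cw  = sameColour-dominator qu′ qw j≢i (≢-≢⇒≡ cu≢cu′ cu≢cw)

  source-if-others-alone : ∀ {k} {q : Labelling k} {v i} → UpperDomatic q → q v ≡ just i →
    (∀ w → c w ≢ c v → Alone q w) → Source q i
  source-if-others-alone {v = v} (_ , compare) qv alone j j≢i w qw with c v ≟ᵇ c w
  ... | yes cv≡cw = sameColour-dominator qv qw j≢i cv≡cw
  ... | no cv≢cw with compare _ _ (≢-sym j≢i)
  ...   | inj₁ i⇉j = i⇉j w qw
  ...   | inj₂ j⇉i with j⇉i v qv
  ...     | u , qu , adj with alone w (≢-sym cv≢cw) u (j , qu , qw)
  ...       | refl = v , qv , trans (Graph.sym G v u) adj

  alone-refinement : ∀ {k} {q : Labelling (suc k)} b → UpperDomatic q →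
    (∀ w → c w ≡ b → Alone q w) → SourceRefinement q
  alone-refinement {q = q} b ud alone with any? (λ v → assigned? (q v) ×-dec ¬? (c v ≟ᵇ b))
  ... | yes (v , (i , qv) , cv≢b) =
    q , i , ud , source-if-others-alone ud qv others-alone , ⊆-refl
    where
    others-alone : ∀ w → c w ≢ c v → Alone q w
    others-alone w cw≢cv = alone w (≢-≢⇒≡ (≢-sym cw≢cv) cv≢b)
  ... | no onlyB with proj₁ ud zero
  ...   | v , qv = q , zero , ud , source-if-others-alone ud qv others-unassigned , ⊆-refl
    where
    cv≡b : c v ≡ b
    cv≡b = decidable-stable (c v ≟ᵇ b) λ cv≢b → onlyB (v , (zero , qv) , cv≢b)
    others-unassigned : ∀ w → c w ≢ c v → Alone q w
    others-unassigned w cw≢cv _ (j , _ , qw) =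
      contradiction (w , (j , qw) , λ cw≡b → cw≢cv (trans cw≡b (≡.sym cv≡b))) onlyB

  exchange-refinement : ∀ {k} {q : Labelling (suc k)} {u u′ w w′ i j} → UpperDomatic q →
    q u ≡ just i → q u′ ≡ just i → q w ≡ just j → q w′ ≡ just j →
    i ≢ j → u′ ≢ u → w′ ≢ w → c w ≢ c u′ → c u ≢ c w′ → SourceRefinement q
  exchange-refinement {q = q} {u} {u′} {w} {w′} {i} {j}
    ud qu qu′ qw qw′ i≢j u′≢u w′≢w cw≢cu′ cu≢cw′ =
    q₁ , i , ud₁ , source-i , exchange-⊆ qu qw
    where
    q₁ : Labelling _
    q₁ = exchange u w q
    q₁u : q₁ u ≡ just j
    q₁u = trans (exchange-left q u w) qw
    q₁w : q₁ w ≡ just i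
    q₁w = trans (exchange-right q u w (labels-distinct qu qw i≢j)) qu
    q₁u′ : q₁ u′ ≡ just i
    q₁u′ = trans (exchange-other q u w u′≢u (labels-distinct qu′ qw i≢j)) qu′
    q₁w′ : q₁ w′ ≡ just j
    q₁w′ = trans (exchange-other q u w (labels-distinct qw′ qu (≢-sym i≢j)) w′≢w) qw′
    source-i : Source q₁ i
    source-i = source-if-mixed q₁w q₁u′ cw≢cu′
    source-j : Source q₁ j
    source-j = source-if-mixed q₁u q₁w′ cu≢cw′
    ud₁ : UpperDomatic q₁
    ud₁ = upperDomatic-replace ud (exchange-agrees qu qw) (w , q₁w) (u , q₁u) source-i source-j

  Mixed : ∀ {k} → Labelling k → Set
  Mixed q = ∃₂ λ u u′ → SamePart q u u′ × c u ≢ c u′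

  mixed? : ∀ {k} (q : Labelling k) → Dec (Mixed q)
  mixed? q = any? λ u → any? λ u′ → samePart? q u u′ ×-dec ¬? (c u ≟ᵇ c u′)

  Shared : ∀ {k} → Labelling k → Bool → Set
  Shared q b = ∃₂ λ u u′ → u′ ≢ u × SamePart q u u′ × c u ≡ b

  shared? : ∀ {k} (q : Labelling k) b → Dec (Shared q b)
  shared? q b = any? λ u → any? λ u′ → ¬? (u′ ≟ u) ×-dec samePart? q u u′ ×-dec (c u ≟ᵇ b)

  alone-if-unshared : ∀ {k} {q : Labelling k} {b} → ¬ Shared q b → ∀ w → c w ≡ b → Alone q w
  alone-if-unshared unshared w cw≡b u (i , qu , qw) =
    decidable-stable (u ≟ w) λ u≢w → unshared (w , u , u≢w , (i , qw , qu) , cw≡b)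

  sourceRefinements : AdmitsSourceRefinements
  sourceRefinements q ud with mixed? q
  ... | yes (u , u′ , (i , qu , qu′) , cu≢cu′) =
    q , i , ud , source-if-mixed qu qu′ cu≢cu′ , ⊆-refl
  ... | no unmixed with shared? q true | shared? q false
  ...   | no unshared | _           = alone-refinement true ud (alone-if-unshared unshared)
  ...   | _           | no unshared = alone-refinement false ud (alone-if-unshared unshared)
  ...   | yes (u , u′ , u′≢u , (i , qu , qu′) , cu)
        | yes (w , w′ , w′≢w , (j , qw , qw′) , cw) =
    exchange-refinement ud qu qu′ qw qw′ i≢j u′≢u w′≢w cw≢cu′ cu≢cw′
    where
    monochromatic : ∀ {x y} → SamePart q x y → c x ≡ c y
    monochromatic {x} {y} xy =
      decidable-stable (c x ≟ᵇ c y) λ cx≢cy → unmixed (x , y , xy , cx≢cy)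
    cu≢cw : c u ≢ c w
    cu≢cw rewrite cu | cw = λ ()
    i≢j : i ≢ j
    i≢j refl = cu≢cw (monochromatic (i , qu , qw))
    cw≢cu′ : c w ≢ c u′
    cw≢cu′ cw≡cu′ = cu≢cw (trans (monochromatic (i , qu , qu′)) (≡.sym cw≡cu′))
    cu≢cw′ : c u ≢ c w′
    cu≢cw′ cu≡cw′ = cu≢cw (trans cu≡cw′ (≡.sym (monochromatic (j , qw , qw′))))

theorem4 : ∀ {n} (G : Graph n) → CoBipartite G →
    ∀ t d → IsTr G t → IsD G d → t ≡ d
theorem4 G (H , (c , bipartite) , G≡H̄) t d (hasTr , maxTr) (hasD , maxD) =
  ≤-antisym (maxD t (transitive⇒upperDomatic G hasTr))
            (maxTr d (upperDomatic⇒transitive sourceRefinements hasD))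
  where
  open Partial G
  open CliqueCover G c (coBipartite-sameColour⇒adjacent {G = G} {H} bipartite G≡H̄)
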